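{- Define recursively $(a_0,b_0)=(3,6)$ and, for all $n\ge 1$, $a_n=\mathrm{mex}(\{a_i,b_i: i<n\}\cup\{0,1,2\})$ and $b_n=a_n+n+3$. Then the set of non-terminal $\mathcal{P}$-positions of $K^2$ is $\{(a_n,b_n): n\ge 0\}\cup\{(b_n,a_n): n\ge 0\}$.
   Context: $\mathrm{mex}\,S=\min(\mathbb{N}\setminus S)$. Positions are pairs $(x,y)\in\mathbb{N}^2$. A Wythoff move from $(x,y)$ leads to $(x-i,y)$ with $1\le i\le x$, to $(x,y-i)$ with $1\le i\le y$, or to $(x-i,y-i)$ with $1\le i\le\min(x,y)$. For $\ell\in\mathbb{N}$, $K^\ell$ is the two-player impartial game with Wythoff moves in which the positions of $\{(x,y): x+y\le\ell\}$ are terminal: no move is allowed from a terminal position, and a player who moves into a terminal position wins (normal play). A $\mathcal{P}$-position is a position from which the previous player has a winning strategy. -}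

module Defs where

open import Data.Nat using (ℕ; zero; suc; _+_; _∸_; _≤_; _<_; _⊓_)
open import Data.Nat.Properties using (_≟_)
open import Data.List using (List; []; _∷_; length)
open import Data.List.Membership.DecPropositional _≟_ using (_∈?_)
open import Data.Product using (_×_; _,_; proj₁; proj₂)
open import Relation.Nullary using (yes; no)

mexAux : ℕ → ℕ → List ℕ → ℕ
mexAux zero    k L = k
mexAux (suc f) k L with k ∈? L
... | yes _ = mexAux f (suc k) L
... | no  _ = k

-- mex L = min (ℕ ∖ L); it is always ≤ length L, so fuel suc (length L) suffices
mex : List ℕ → ℕ
mex L = mexAux (suc (length L)) 0 L

mutual
  ab : ℕ → ℕ × ℕ
  ab zero    = 3 , 6
  ab (suc n) = mex (0 ∷ 1 ∷ 2 ∷ hist (suc n)) , mex (0 ∷ 1 ∷ 2 ∷ hist (suc n)) + suc n + 3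

  hist : ℕ → List ℕ
  hist zero    = []
  hist (suc n) = proj₁ (ab n) ∷ proj₂ (ab n) ∷ hist n

a : ℕ → ℕ
a n = proj₁ (ab n)

b : ℕ → ℕ
b n = proj₂ (ab n)

-- The game K^ℓ : Wythoff moves, positions with x + y ≤ ℓ terminal

data Move (ℓ : ℕ) : ℕ → ℕ → ℕ → ℕ → Set where
  moveX : ∀ {x y} i → 1 ≤ i → i ≤ x → ℓ < x + y → Move ℓ x y (x ∸ i) y
  moveY : ∀ {x y} i → 1 ≤ i → i ≤ y → ℓ < x + y → Move ℓ x y x (y ∸ i)
  moveD : ∀ {x y} i → 1 ≤ i → i ≤ x ⊓ y → ℓ < x + y → Move ℓ x y (x ∸ i) (y ∸ i)

-- P- and N-positions (normal play): a position is P iff every option is N,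
-- and N iff some option is P (so terminal positions, having no options, are P).
mutual
  data IsP (ℓ : ℕ) (x y : ℕ) : Set where
    allOptionsN : (∀ x' y' → Move ℓ x y x' y' → IsN ℓ x' y') → IsP ℓ x y

  data IsN (ℓ : ℕ) (x y : ℕ) : Set where
    someOptionP : ∀ x' y' → Move ℓ x y x' y' → IsP ℓ x' y' → IsN ℓ x y

{-# OPTIONS --safe #-}
-- The P-positions of a game on ℕ² whose moves decrease x + y are the unique kernel of its
-- move graph: a set with no move between two of its members into which every other position
-- can move.  The candidate kernel of K² is the terminal triangle together with the pairs
-- (aₙ, bₙ), (bₙ, aₙ).  It is independent because the pair (aₙ, bₙ) is the only one in row
-- aₙ, in column bₙ and on the diagonal y − x = n + 3 (a and b are strictly increasing and
-- disjoint).  It is absorbing because, by the mex rule, a and b partition {3, 4, …}: from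
-- (x, x + d) with x, d ≥ 3 either x = bₙ and we move to (bₙ, aₙ), or x = aₙ and we move
-- down to (aₙ, bₙ) if d > n + 3, or diagonally to (a_{d−3}, b_{d−3}) if d < n + 3; when
-- x ≤ 2 or d ≤ 2 a terminal position is one move away.
module Submission where

open import Defs
open import Data.Fin using (Fin; toℕ)
open import Data.Fin.Properties using (injective⇒≤; toℕ<n; toℕ-injective)
open import Data.List using (List; _∷_; length; lookup)
open import Data.List.Relation.Binary.Subset.Propositional using (_⊆_)
open import Data.List.Relation.Binary.Subset.Propositional.Properties using (∷⁺ʳ)
open import Data.List.Relation.Unary.Any using (here; there; index)
open import Data.List.Relation.Unary.Any.Properties using (lookup-index)
open import Data.Nat using (ℕ; zero; suc; _+_; _∸_; _≤_; _<_; _≤′_; ≤′-refl; ≤′-step; z≤n; s≤s; z<s)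
open import Data.Nat.Induction using (<-wellFounded)
open import Data.Nat.Properties
open import Data.List.Membership.DecPropositional _≟_ using (_∈_; _∉_; _∈?_)
open import Algebra.Properties.CommutativeSemigroup +-commutativeSemigroup using (xy∙z≈xz∙y)
open import Data.Product using (_×_; ∃; ∃₂; _,_; proj₁; proj₂)
open import Data.Sum using (_⊎_; inj₁; inj₂; [_,_]′)
import Data.Sum as Sum
open import Function using (id; _∘_)
open import Function.Bundles using (_⇔_; mk⇔; Equivalence)
open import Function.Definitions using (Injective)
open import Induction.WellFounded using (Acc; acc)
open import Relation.Binary using (tri<; tri≈; tri>)
open import Relation.Binary.PropositionalEquality
open import Relation.Nullary using (¬_; yes; no; contradiction)

range⊆⇒≤length : ∀ {m} (L : List ℕ) → (∀ {j} → j < m → j ∈ L) → m ≤ length L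
range⊆⇒≤length {m} L range⊆L = injective⇒≤ position-injective
  where
  position : Fin m → Fin (length L)
  position j = index (range⊆L (toℕ<n j))

  position-injective : Injective _≡_ _≡_ position
  position-injective {i} {j} eq = toℕ-injective (begin
    toℕ i                ≡⟨ lookup-index (range⊆L (toℕ<n i)) ⟩
    lookup L (position i) ≡⟨ cong (lookup L) eq ⟩
    lookup L (position j) ≡⟨ lookup-index (range⊆L (toℕ<n j)) ⟨
    toℕ j                ∎)
    where open ≡-Reasoning

IsMex : List ℕ → ℕ → Set
IsMex L k = k ∉ L × (∀ {j} → j < k → j ∈ L)

mexAux-isMex : ∀ f k L → (∀ {j} → j < k → j ∈ L) → length L < k + f → IsMex L (mexAux f k L)
mexAux-isMex zero k L below bound =
  contradiction (range⊆⇒≤length L below) (<⇒≱ (subst (length L <_) (+-identityʳ k) bound))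
mexAux-isMex (suc f) k L below bound with k ∈? L
... | no k∉L = k∉L , below
... | yes k∈L = mexAux-isMex f (suc k) L below′ (subst (length L <_) (+-suc k f) bound)
  where
  below′ : ∀ {j} → j < suc k → j ∈ L
  below′ j<1+k = [ below , (λ { refl → k∈L }) ]′ (m<1+n⇒m<n∨m≡n j<1+k)

mex-isMex : ∀ L → IsMex L (mex L)
mex-isMex L = mexAux-isMex (suc (length L)) 0 L (λ ()) ≤-refl

excluded : ℕ → List ℕ
excluded n = 0 ∷ 1 ∷ 2 ∷ hist n

a-isMex : ∀ n → IsMex (excluded n) (a n)
a-isMex zero    = mex-isMex (excluded zero)
a-isMex (suc n) = mex-isMex (excluded (suc n))

a∉excluded : ∀ n → a n ∉ excluded n
a∉excluded n = proj₁ (a-isMex n)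

<a⇒∈excluded : ∀ n {j} → j < a n → j ∈ excluded n
<a⇒∈excluded n = proj₂ (a-isMex n)

b≡a+3+n : ∀ n → b n ≡ a n + (3 + n)
b≡a+3+n zero    = refl
b≡a+3+n (suc n) = trans (+-assoc (a (suc n)) (suc n) 3) (cong (a (suc n) +_) (+-comm (suc n) 3))

hist-mono : ∀ {m n} → m ≤′ n → hist m ⊆ hist n
hist-mono ≤′-refl        = id
hist-mono (≤′-step m≤′n) = there ∘ there ∘ hist-mono m≤′n

excluded-mono : ∀ {m n} → m ≤ n → excluded m ⊆ excluded n
excluded-mono m≤n = ∷⁺ʳ 0 (∷⁺ʳ 1 (∷⁺ʳ 2 (hist-mono (≤⇒≤′ m≤n))))

a∉hist : ∀ n → a n ∉ hist n
a∉hist n = a∉excluded n ∘ there ∘ there ∘ there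

a∈hist : ∀ {m n} → m < n → a m ∈ hist n
a∈hist m<n = hist-mono (≤⇒≤′ m<n) (here refl)

b∈hist : ∀ {m n} → m < n → b m ∈ hist n
b∈hist m<n = hist-mono (≤⇒≤′ m<n) (there (here refl))

∈hist⇒∈ab : ∀ {n v} → v ∈ hist n → ∃ λ i → v ≡ a i ⊎ v ≡ b i
∈hist⇒∈ab {suc n} (here v≡a)         = n , inj₁ v≡a
∈hist⇒∈ab {suc n} (there (here v≡b)) = n , inj₂ v≡b
∈hist⇒∈ab {suc n} (there (there v∈)) = ∈hist⇒∈ab v∈

3≤a : ∀ n → 3 ≤ a n
3≤a n with a n | a∉excluded n
... | 0                 | a∉ = contradiction (here refl) a∉
... | 1                 | a∉ = contradiction (there (here refl)) a∉
... | 2                 | a∉ = contradiction (there (there (here refl))) a∉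
... | suc (suc (suc _)) | _  = s≤s (s≤s (s≤s z≤n))

a-mono-< : ∀ {m n} → m < n → a m < a n
a-mono-< {m} {n} m<n = ≤∧≢⇒< (≮⇒≥ an≮am) am≢an
  where
  an≮am : ¬ a n < a m
  an≮am an<am = a∉excluded n (excluded-mono (<⇒≤ m<n) (<a⇒∈excluded m an<am))

  am≢an : a m ≢ a n
  am≢an am≡an = a∉hist n (subst (_∈ hist n) am≡an (a∈hist m<n))

a<b : ∀ n → a n < b n
a<b n = subst (a n <_) (sym (b≡a+3+n n)) (m<m+n (a n) z<s)

3≤b : ∀ n → 3 ≤ b n
3≤b n = ≤-trans (3≤a n) (<⇒≤ (a<b n))

b-mono-< : ∀ {m n} → m < n → b m < b n
b-mono-< {m} {n} m<n = subst₂ _<_ (sym (b≡a+3+n m)) (sym (b≡a+3+n n))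
  (+-mono-< (a-mono-< m<n) (+-monoʳ-< 3 m<n))

strictMono⇒injective : ∀ {f : ℕ → ℕ} → (∀ {m n} → m < n → f m < f n) → Injective _≡_ _≡_ f
strictMono⇒injective f-mono {m} {n} fm≡fn with <-cmp m n
... | tri< m<n _ _ = contradiction fm≡fn (<⇒≢ (f-mono m<n))
... | tri≈ _ m≡n _ = m≡n
... | tri> _ _ n<m = contradiction (sym fm≡fn) (<⇒≢ (f-mono n<m))

a-injective : Injective _≡_ _≡_ a
a-injective = strictMono⇒injective a-mono-<

b-injective : Injective _≡_ _≡_ b
b-injective = strictMono⇒injective b-mono-<

a≢b : ∀ m n → a m ≢ b n
a≢b m n with <-cmp m n
... | tri< m<n _ _ = <⇒≢ (<-trans (a-mono-< m<n) (a<b n))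
... | tri≈ _ refl _ = <⇒≢ (a<b n)
... | tri> _ _ n<m = λ am≡bn → a∉hist m (subst (_∈ hist m) (sym am≡bn) (b∈hist n<m))

3+n≤a : ∀ n → 3 + n ≤ a n
3+n≤a zero    = 3≤a zero
3+n≤a (suc n) = ≤-<-trans (3+n≤a n) (a-mono-< (n<1+n n))

3≤⇒a-or-b : ∀ x → 3 ≤ x → ∃ λ n → x ≡ a n ⊎ x ≡ b n
3≤⇒a-or-b x 3≤x with <a⇒∈excluded x (<-≤-trans (m<n+m x z<s) (3+n≤a x))
... | here refl                    = contradiction z≤n (<⇒≱ 3≤x)
... | there (here refl)            = contradiction (s≤s z≤n) (<⇒≱ 3≤x)
... | there (there (here refl))    = contradiction ≤-refl (<⇒≱ 3≤x)
... | there (there (there x∈hist)) = ∈hist⇒∈ab x∈hist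

data Step (x y : ℕ) : ℕ → ℕ → Set where
  horizontal : ∀ {x′} → x′ < x → Step x y x′ y
  vertical   : ∀ {y′} → y′ < y → Step x y x y′
  diagonal   : ∀ {x′ y′} i → 0 < i → x ≡ x′ + i → y ≡ y′ + i → Step x y x′ y′

move⇒step : ∀ {ℓ x y x′ y′} → Move ℓ x y x′ y′ → Step x y x′ y′
move⇒step (moveX i 0<i i≤x _) = horizontal (∸-monoʳ-< 0<i i≤x)
move⇒step (moveY i 0<i i≤y _) = vertical (∸-monoʳ-< 0<i i≤y)
move⇒step {x = x} {y} (moveD i 0<i i≤x⊓y _) = diagonal i 0<i
  (sym (m∸n+n≡m (≤-trans i≤x⊓y (m⊓n≤m x y))))
  (sym (m∸n+n≡m (≤-trans i≤x⊓y (m⊓n≤n x y))))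

step⇒move : ∀ {ℓ x y x′ y′} → Step x y x′ y′ → ℓ < x + y → Move ℓ x y x′ y′
step⇒move {ℓ} {x} {y} (horizontal {x′} x′<x) ℓ<x+y =
  subst (λ x″ → Move ℓ x y x″ y) (m∸[m∸n]≡n (<⇒≤ x′<x))
    (moveX (x ∸ x′) (m<n⇒0<n∸m x′<x) (m∸n≤m x x′) ℓ<x+y)
step⇒move {ℓ} {x} {y} (vertical {y′} y′<y) ℓ<x+y =
  subst (Move ℓ x y x) (m∸[m∸n]≡n (<⇒≤ y′<y))
    (moveY (y ∸ y′) (m<n⇒0<n∸m y′<y) (m∸n≤m y y′) ℓ<x+y)
step⇒move {ℓ} (diagonal {x′} {y′} i 0<i refl refl) ℓ<x+y =
  subst₂ (Move ℓ (x′ + i) (y′ + i)) (m+n∸n≡m x′ i) (m+n∸n≡m y′ i)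
    (moveD i 0<i (⊓-glb (m≤n+m i x′) (m≤n+m i y′)) ℓ<x+y)

move-nonterminal : ∀ {ℓ x y x′ y′} → Move ℓ x y x′ y′ → ℓ < x + y
move-nonterminal (moveX _ _ _ ℓ<x+y) = ℓ<x+y
move-nonterminal (moveY _ _ _ ℓ<x+y) = ℓ<x+y
move-nonterminal (moveD _ _ _ ℓ<x+y) = ℓ<x+y

step-swap : ∀ {x y x′ y′} → Step x y x′ y′ → Step y x y′ x′
step-swap (horizontal x′<x)             = vertical x′<x
step-swap (vertical y′<y)               = horizontal y′<y
step-swap (diagonal i 0<i x≡x′+i y≡y′+i) = diagonal i 0<i y≡y′+i x≡x′+i

step-sum-< : ∀ {x y x′ y′} → Step x y x′ y′ → x′ + y′ < x + y
step-sum-< {y = y} (horizontal x′<x)          = +-monoˡ-< y x′<x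
step-sum-< {x = x} (vertical y′<y)            = +-monoʳ-< x y′<y
step-sum-< (diagonal {x′} {y′} i 0<i refl refl) = +-mono-< (m<m+n x′ 0<i) (m<m+n y′ 0<i)

move-sum-< : ∀ {ℓ x y x′ y′} → Move ℓ x y x′ y′ → x′ + y′ < x + y
move-sum-< = step-sum-< ∘ move⇒step

diagonal-step : ∀ {x x′} d → x′ < x → Step x (x + d) x′ (x′ + d)
diagonal-step {x} {x′} d x′<x = diagonal (x ∸ x′) (m<n⇒0<n∸m x′<x) x≡x′+i
  (trans (cong (_+ d) x≡x′+i) (xy∙z≈xz∙y x′ (x ∸ x′) d))
  where
  x≡x′+i : x ≡ x′ + (x ∸ x′)
  x≡x′+i = sym (m+[n∸m]≡n (<⇒≤ x′<x))

diagonal-difference : ∀ {x y x′ y′ i d} → x ≡ x′ + i → y ≡ y′ + i → y ≡ x + d → y′ ≡ x′ + d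
diagonal-difference {x} {y} {x′} {y′} {i} {d} x≡x′+i y≡y′+i y≡x+d = +-cancelʳ-≡ i y′ (x′ + d) (begin
  y′ + i     ≡⟨ y≡y′+i ⟨
  y          ≡⟨ y≡x+d ⟩
  x + d      ≡⟨ cong (_+ d) x≡x′+i ⟩
  x′ + i + d ≡⟨ xy∙z≈xz∙y x′ i d ⟩
  x′ + d + i ∎)
  where open ≡-Reasoning

module _ {ℓ : ℕ} (K : ℕ → ℕ → Set)
  (independent : ∀ {x y x′ y′} → K x y → Move ℓ x y x′ y′ → ¬ K x′ y′)
  (absorbing : ∀ x y → K x y ⊎ ∃₂ λ x′ y′ → Move ℓ x y x′ y′ × K x′ y′)
  where

  P⇒¬N : ∀ {x y} → IsP ℓ x y → ¬ IsN ℓ x y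
  P⇒¬N (allOptionsN optionsN) (someOptionP x′ y′ m p) = P⇒¬N p (optionsN x′ y′ m)

  mutual
    kernel⇒P : ∀ {x y} → Acc _<_ (x + y) → K x y → IsP ℓ x y
    kernel⇒P (acc smaller) k = allOptionsN λ x′ y′ m →
      ¬kernel⇒N (smaller (move-sum-< m)) (independent k m)

    ¬kernel⇒N : ∀ {x y} → Acc _<_ (x + y) → ¬ K x y → IsN ℓ x y
    ¬kernel⇒N {x} {y} (acc smaller) ¬k with absorbing x y
    ... | inj₁ k                  = contradiction k ¬k
    ... | inj₂ (x′ , y′ , m , k′) = someOptionP x′ y′ m (kernel⇒P (smaller (move-sum-< m)) k′)

  kernel⇔P : ∀ x y → K x y ⇔ IsP ℓ x y
  kernel⇔P x y = mk⇔ (kernel⇒P (<-wellFounded (x + y))) P⇒kernel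
    where
    P⇒kernel : IsP ℓ x y → K x y
    P⇒kernel p with absorbing x y
    ... | inj₁ k                  = k
    ... | inj₂ (x′ , y′ , m , k′) = contradiction (someOptionP x′ y′ m (kernel⇒P (<-wellFounded _) k′)) (P⇒¬N p)

SequencePair : ℕ → ℕ → Set
SequencePair x y = ∃ λ n → (x ≡ a n × y ≡ b n) ⊎ (x ≡ b n × y ≡ a n)

Kernel₂ : ℕ → ℕ → Set
Kernel₂ x y = x + y ≤ 2 ⊎ SequencePair x y

StepsIntoKernel₂ : ℕ → ℕ → Set
StepsIntoKernel₂ x y = ∃₂ λ x′ y′ → Step x y x′ y′ × Kernel₂ x′ y′

pair-a-b : ∀ n → SequencePair (a n) (b n)
pair-a-b n = n , inj₁ (refl , refl)

pair-b-a : ∀ n → SequencePair (b n) (a n)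
pair-b-a n = n , inj₂ (refl , refl)

pair-swap : ∀ {x y} → SequencePair x y → SequencePair y x
pair-swap (n , inj₁ (x≡a , y≡b)) = n , inj₂ (y≡b , x≡a)
pair-swap (n , inj₂ (x≡b , y≡a)) = n , inj₁ (y≡a , x≡b)

kernel₂-swap : ∀ {x y} → Kernel₂ x y → Kernel₂ y x
kernel₂-swap {x} {y} (inj₁ x+y≤2) = inj₁ (subst (_≤ 2) (+-comm x y) x+y≤2)
kernel₂-swap (inj₂ pair)          = inj₂ (pair-swap pair)

pair-nonterminal : ∀ {x y} → SequencePair x y → 2 < x + y
pair-nonterminal {y = y} (n , inj₁ (refl , _)) = ≤-trans (3≤a n) (m≤m+n (a n) y)
pair-nonterminal {x = x} (n , inj₂ (_ , refl)) = ≤-trans (3≤a n) (m≤n+m (a n) x)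

nonterminal-kernel₂⇒pair : ∀ {x y} → 2 < x + y → Kernel₂ x y → SequencePair x y
nonterminal-kernel₂⇒pair 2<x+y (inj₁ x+y≤2) = contradiction x+y≤2 (<⇒≱ 2<x+y)
nonterminal-kernel₂⇒pair _     (inj₂ pair)  = pair

kernel₂-left≥3⇒pair : ∀ {x y} → 3 ≤ x → Kernel₂ x y → SequencePair x y
kernel₂-left≥3⇒pair {x} {y} 3≤x = nonterminal-kernel₂⇒pair (≤-trans 3≤x (m≤m+n x y))

kernel₂-right≥3⇒pair : ∀ {x y} → 3 ≤ y → Kernel₂ x y → SequencePair x y
kernel₂-right≥3⇒pair {x} {y} 3≤y = nonterminal-kernel₂⇒pair (≤-trans 3≤y (m≤n+m y x))

pair-in-row-a : ∀ {n y} → SequencePair (a n) y → y ≡ b n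
pair-in-row-a {n} (k , inj₁ (an≡ak , y≡bk)) = trans y≡bk (cong b (sym (a-injective {n} {k} an≡ak)))
pair-in-row-a {n} (k , inj₂ (an≡bk , _)) = contradiction an≡bk (a≢b n k)

pair-in-column-b : ∀ {n x} → SequencePair x (b n) → x ≡ a n
pair-in-column-b {n} (k , inj₁ (x≡ak , bn≡bk)) = trans x≡ak (cong a (sym (b-injective {n} {k} bn≡bk)))
pair-in-column-b {n} (k , inj₂ (_ , bn≡ak)) = contradiction (sym bn≡ak) (a≢b k n)

pair-on-diagonal : ∀ {n x} → SequencePair x (x + (3 + n)) → x ≡ a n
pair-on-diagonal {n} (k , inj₁ (refl , e)) =
  cong a (sym (+-cancelˡ-≡ 3 n k (+-cancelˡ-≡ (a k) (3 + n) (3 + k) (trans e (b≡a+3+n k)))))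
pair-on-diagonal {n} (k , inj₂ (refl , e)) =
  contradiction (≤-trans (m≤m+n (b k) (3 + n)) (≤-reflexive e)) (<⇒≱ (a<b k))

pair-step⇒¬kernel₂ : ∀ n {x′ y′} → Step (a n) (b n) x′ y′ → ¬ Kernel₂ x′ y′
pair-step⇒¬kernel₂ n {x′} (horizontal x′<an) k =
  <⇒≢ x′<an (pair-in-column-b {n} (kernel₂-right≥3⇒pair (3≤b n) k))
pair-step⇒¬kernel₂ n (vertical y′<bn) k =
  <⇒≢ y′<bn (pair-in-row-a {n} (kernel₂-left≥3⇒pair (3≤a n) k))
pair-step⇒¬kernel₂ n {x′} (diagonal i 0<i an≡x′+i bn≡y′+i) k =
  <⇒≢ (m<m+n x′ 0<i) (trans (pair-on-diagonal {n} on-diagonal) an≡x′+i)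
  where
  on-diagonal : SequencePair x′ (x′ + (3 + n))
  on-diagonal = kernel₂-right≥3⇒pair (≤-trans (m≤m+n 3 n) (m≤n+m (3 + n) x′))
    (subst (Kernel₂ x′) (diagonal-difference an≡x′+i bn≡y′+i (b≡a+3+n n)) k)

kernel₂-independent : ∀ {x y x′ y′} → Kernel₂ x y → Move 2 x y x′ y′ → ¬ Kernel₂ x′ y′
kernel₂-independent (inj₁ x+y≤2) m = contradiction x+y≤2 (<⇒≱ (move-nonterminal m))
kernel₂-independent (inj₂ (n , inj₁ (refl , refl))) m = pair-step⇒¬kernel₂ n (move⇒step m)
kernel₂-independent (inj₂ (n , inj₂ (refl , refl))) m =
  pair-step⇒¬kernel₂ n (step-swap (move⇒step m)) ∘ kernel₂-swap

row-a-absorbing : ∀ n e → SequencePair (a n) (a n + (3 + e)) ⊎ StepsIntoKernel₂ (a n) (a n + (3 + e))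
row-a-absorbing n e with <-cmp e n
... | tri≈ _ refl _ = inj₁ (n , inj₁ (refl , sym (b≡a+3+n n)))
... | tri> _ _ n<e  = inj₂ (a n , b n , vertical bn<y , inj₂ (pair-a-b n))
  where
  bn<y : b n < a n + (3 + e)
  bn<y = subst (_< a n + (3 + e)) (sym (b≡a+3+n n)) (+-monoʳ-< (a n) (+-monoʳ-< 3 n<e))
... | tri< e<n _ _  = inj₂ (a e , b e , to-pair-e , inj₂ (pair-a-b e))
  where
  to-pair-e : Step (a n) (a n + (3 + e)) (a e) (b e)
  to-pair-e = subst (Step (a n) (a n + (3 + e)) (a e)) (sym (b≡a+3+n e)) (diagonal-step (3 + e) (a-mono-< e<n))

ordered-absorbing : ∀ x d → 2 < x + (x + d) → SequencePair x (x + d) ⊎ StepsIntoKernel₂ x (x + d)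
ordered-absorbing x d 2<x+y with x ≤? 2
... | yes x≤2 = let k , x+k≡2 = m≤n⇒∃[o]m+o≡n x≤2 in
  inj₂ (x , k , vertical (+-cancelˡ-< x k (x + d) (subst (_< x + (x + d)) (sym x+k≡2) 2<x+y)) ,
        inj₁ (≤-reflexive x+k≡2))
... | no x≰2 with d ≤? 2
...   | yes d≤2 = inj₂ (0 , d , diagonal-step d (≤-trans z<s (≰⇒> x≰2)) , inj₁ d≤2)
...   | no d≰2 with m≤n⇒∃[o]m+o≡n (≰⇒> d≰2) | 3≤⇒a-or-b x (≰⇒> x≰2)
...     | e , refl | n , inj₁ refl = row-a-absorbing n e
...     | e , refl | n , inj₂ refl =
  inj₂ (b n , a n , vertical (<-≤-trans (a<b n) (m≤m+n (b n) (3 + e))) , inj₂ (pair-b-a n))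

nonterminal-absorbing : ∀ x y → 2 < x + y → SequencePair x y ⊎ StepsIntoKernel₂ x y
nonterminal-absorbing x y 2<x+y with ≤-total x y
... | inj₁ x≤y with m≤n⇒∃[o]m+o≡n x≤y
...   | d , refl = ordered-absorbing x d 2<x+y
nonterminal-absorbing x y 2<x+y | inj₂ y≤x with m≤n⇒∃[o]m+o≡n y≤x
...   | d , refl = Sum.map pair-swap swap-steps (ordered-absorbing y d (subst (2 <_) (+-comm (y + d) y) 2<x+y))
  where
  swap-steps : StepsIntoKernel₂ y (y + d) → StepsIntoKernel₂ (y + d) y
  swap-steps (x′ , y′ , s , k) = y′ , x′ , step-swap s , kernel₂-swap k

kernel₂-absorbing : ∀ x y → Kernel₂ x y ⊎ ∃₂ λ x′ y′ → Move 2 x y x′ y′ × Kernel₂ x′ y′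
kernel₂-absorbing x y with x + y ≤? 2
... | yes x+y≤2 = inj₁ (inj₁ x+y≤2)
... | no x+y≰2  = Sum.map inj₂ (λ (x′ , y′ , s , k) → x′ , y′ , step⇒move s (≰⇒> x+y≰2) , k)
  (nonterminal-absorbing x y (≰⇒> x+y≰2))

proposition16 : ∀ x y → ((2 < x + y) × IsP 2 x y) ⇔ (∃ λ n → (x ≡ a n × y ≡ b n) ⊎ (x ≡ b n × y ≡ a n))
proposition16 x y = mk⇔
  (λ (2<x+y , p) → nonterminal-kernel₂⇒pair 2<x+y (Equivalence.from kernel₂⇔P p))
  (λ pair → pair-nonterminal pair , Equivalence.to kernel₂⇔P (inj₂ pair))
  where
  kernel₂⇔P : Kernel₂ x y ⇔ IsP 2 x y
  kernel₂⇔P = kernel⇔P Kernel₂ kernel₂-independent kernel₂-absorbing x y
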